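{- Let $\mathsf X\subseteq\{\mathsf d,\mathsf t,\mathsf b,\mathsf 4,\mathsf 5\}$. If a nested sequent is provable in $\mathsf K_{\mathsf c}+[\mathsf X]$, then its corresponding formula is provable in a Hilbert system for the modal logic $\mathsf K$ extended by the axioms in $\mathsf X$.
   Context: Formulas: $A::=p\mid\bar p\mid A\vee A\mid A\wedge A\mid\Diamond A\mid\Box A$, $\bar A$ by De Morgan laws. A nested sequent is a finite multiset of formulas and boxed sequents $[\Delta]$; the corresponding formula of $A_1,\dots,A_m,[\Delta_1],\dots,[\Delta_n]$ is $A_1\vee\dots\vee A_m\vee\Box F_1\vee\dots\vee\Box F_n$ ($F_j$ that of $\Delta_j$; $\bot$ if empty). Contexts $\Gamma\{\ \}$, filling, binary contexts, and depth of $\Gamma\{\ \}\{\emptyset\}$ (boxes around the first hole) as usual. System $\mathsf K_{\mathsf c}$ (premises / conclusion): axiom $\Gamma\{p,\bar p\}$; $\wedge$: $\Gamma\{A\},\Gamma\{B\}/\Gamma\{A\wedge B\}$; $\vee$: $\Gamma\{A,B\}/\Gamma\{A\vee B\}$; $\Box$: $\Gamma\{[A]\}/\Gamma\{\Box A\}$; $\mathsf k$: $\Gamma\{[A,\Delta]\}/\Gamma\{\Diamond A,[\Delta]\}$; $\mathsf{ctr}$: $\Gamma\{\Delta,\Delta\}/\Gamma\{\Delta\}$. Structural modal rules: $[\mathsf d]$: $\Gamma\{[\emptyset]\}/\Gamma\{\emptyset\}$; $[\mathsf t]$: $\Gamma\{[\Delta]\}/\Gamma\{\Delta\}$; $[\mathsf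 b]$: $\Gamma\{[\Delta,[\Sigma]]\}/\Gamma\{[\Delta],\Sigma\}$; $[\mathsf 4]$: $\Gamma\{[\Delta],[\Sigma]\}/\Gamma\{[[\Delta],\Sigma]\}$; $[\mathsf 5]$: $\Gamma\{[\Delta]\}\{\emptyset\}/\Gamma\{\emptyset\}\{[\Delta]\}$ provided depth of $\Gamma\{\ \}\{\emptyset\}>0$. $\mathsf K_{\mathsf c}+[\mathsf X]$ adds $[\rho]$ for $\rho\in\mathsf X$. Proofs are finite trees with axiom leaves. Modal axioms: $\mathsf d$: $\Box A\supset\Diamond A$; $\mathsf t$: $A\supset\Diamond A$; $\mathsf b$: $A\supset\Box\Diamond A$; $\mathsf 4$: $\Box A\supset\Box\Box A$; $\mathsf 5$: $\Diamond A\supset\Box\Diamond A$. -}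

module Defs where

open import Data.Nat using (ℕ; zero; suc; _<_)
open import Data.Bool using (Bool; true; false; not; _∧_; _∨_)
open import Data.List using (List; []; _∷_; _++_; [_])
open import Relation.Binary.PropositionalEquality using (_≡_)

-- Formulas in negation normal form (atoms are natural numbers).
-- ⊥ and ⊤ are added so that the corresponding formula of the empty
-- sequent (⊥) exists; ⊤ is its De Morgan dual.

infixr 30 _∧̇_
infixr 25 _∨̇_

data Fm : Set where
  p np    : ℕ → Fm
  ⊥̇ ⊤̇     : Fm
  _∨̇_ _∧̇_ : Fm → Fm → Fm
  ◇ □     : Fm → Fm

neg : Fm → Fm
neg (p n)   = np n
neg (np n)  = p n
neg ⊥̇       = ⊤̇
neg ⊤̇       = ⊥̇
neg (A ∨̇ B) = neg A ∧̇ neg B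
neg (A ∧̇ B) = neg A ∨̇ neg B
neg (◇ A)   = □ (neg A)
neg (□ A)   = ◇ (neg A)

infixr 20 _⊃_
_⊃_ : Fm → Fm → Fm
A ⊃ B = neg A ∨̇ B

-- Multisets are represented by lists; the proof system below contains
-- an exchange rule (at any depth), so provability is invariant under
-- multiset equality.

data Item : Set where
  fm : Fm → Item
  bx : List Item → Item

Seq : Set
Seq = List Item

disj : List Fm → Fm
disj []           = ⊥̇
disj (A ∷ [])     = A
disj (A ∷ B ∷ As) = A ∨̇ disj (B ∷ As)

fmls : Seq → List Fm
fmls []          = []
fmls (fm A ∷ Γ)  = A ∷ fmls Γ
fmls (bx _ ∷ Γ)  = fmls Γ

mutual
  fmla : Seq → Fm
  fmla Γ = disj (fmls Γ ++ boxFs Γ)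

  boxFs : Seq → List Fm
  boxFs []          = []
  boxFs (fm _ ∷ Γ)  = boxFs Γ
  boxFs (bx Δ ∷ Γ)  = □ (fmla Δ) ∷ boxFs Γ

data Ctx : Set where
  here   : Seq → Ctx
  inside : Seq → Ctx → Ctx

fill : Ctx → Seq → Seq
fill (here Δ)     Σ = Δ ++ Σ
fill (inside Δ C) Σ = Δ ++ [ bx (fill C Σ) ]

depth : Ctx → ℕ
depth (here _)     = 0
depth (inside _ C) = suc (depth C)

data Ctx2 : Set where
  both   : Seq → Ctx2
  leftIn  : Seq → Ctx → Ctx2
  rightIn : Seq → Ctx → Ctx2
  split  : Seq → Ctx → Ctx → Ctx2
  deeper : Seq → Ctx2 → Ctx2

fill2 : Ctx2 → Seq → Seq → Seq
fill2 (both Δ)        Σ₁ Σ₂ = Δ ++ Σ₁ ++ Σ₂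
fill2 (leftIn Δ C)    Σ₁ Σ₂ = Δ ++ bx (fill C Σ₁) ∷ Σ₂
fill2 (rightIn Δ C)   Σ₁ Σ₂ = Δ ++ Σ₁ ++ [ bx (fill C Σ₂) ]
fill2 (split Δ C₁ C₂) Σ₁ Σ₂ = Δ ++ bx (fill C₁ Σ₁) ∷ bx (fill C₂ Σ₂) ∷ []
fill2 (deeper Δ K)    Σ₁ Σ₂ = Δ ++ [ bx (fill2 K Σ₁ Σ₂) ]

-- depth of Γ{ }{∅}: number of boxes around the first hole
depth2 : Ctx2 → ℕ
depth2 (both _)        = 0
depth2 (leftIn _ C)    = suc (depth C)
depth2 (rightIn _ _)   = 0
depth2 (split _ C₁ _)  = suc (depth C₁)
depth2 (deeper _ K)    = suc (depth2 K)

data Ax : Set where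
  d t b ax4 ax5 : Ax

-- X ⊆ {d,t,b,4,5} is given as a predicate on Ax

data NProv (X : Ax → Set) : Seq → Set where
  ax    : ∀ C n → NProv X (fill C (fm (p n) ∷ fm (np n) ∷ []))
  ∧R    : ∀ C A B → NProv X (fill C [ fm A ]) → NProv X (fill C [ fm B ])
          → NProv X (fill C [ fm (A ∧̇ B) ])
  ∨R    : ∀ C A B → NProv X (fill C (fm A ∷ fm B ∷ []))
          → NProv X (fill C [ fm (A ∨̇ B) ])
  □R    : ∀ C A → NProv X (fill C [ bx [ fm A ] ]) → NProv X (fill C [ fm (□ A) ])
  kR    : ∀ C A Δ → NProv X (fill C [ bx (fm A ∷ Δ) ])
          → NProv X (fill C (fm (◇ A) ∷ bx Δ ∷ []))
  ctr   : ∀ C Δ → NProv X (fill C (Δ ++ Δ)) → NProv X (fill C Δ)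
  exch  : ∀ C i j Δ → NProv X (fill C (i ∷ j ∷ Δ)) → NProv X (fill C (j ∷ i ∷ Δ))
  dR    : X d → ∀ C → NProv X (fill C [ bx [] ]) → NProv X (fill C [])
  tR    : X t → ∀ C Δ → NProv X (fill C [ bx Δ ]) → NProv X (fill C Δ)
  bR    : X b → ∀ C Δ Σ → NProv X (fill C [ bx (Δ ++ [ bx Σ ]) ])
          → NProv X (fill C (bx Δ ∷ Σ))
  4R    : X ax4 → ∀ C Δ Σ → NProv X (fill C (bx Δ ∷ bx Σ ∷ []))
          → NProv X (fill C [ bx (bx Δ ∷ Σ) ])
  5R    : X ax5 → ∀ K Δ → 0 < depth2 K → NProv X (fill2 K [ bx Δ ] [])
          → NProv X (fill2 K [] [ bx Δ ])

-- propositional evaluation, modal formulas □A treated as atoms and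
-- ◇A as ¬□Ā
record Val : Set where
  field
    atom : ℕ → Bool
    boxv : Fm → Bool
open Val

eval : Val → Fm → Bool
eval v (p n)   = atom v n
eval v (np n)  = not (atom v n)
eval v ⊥̇       = false
eval v ⊤̇       = true
eval v (A ∨̇ B) = eval v A ∨ eval v B
eval v (A ∧̇ B) = eval v A ∧ eval v B
eval v (◇ A)   = not (boxv v (neg A))
eval v (□ A)   = boxv v A

Taut : Fm → Set
Taut A = ∀ v → eval v A ≡ true

data HProv (X : Ax → Set) : Fm → Set where
  taut : ∀ {A} → Taut A → HProv X A
  axK  : ∀ A B → HProv X (□ (A ⊃ B) ⊃ (□ A ⊃ □ B))
  axd  : X d → ∀ A → HProv X (□ A ⊃ ◇ A)
  axt  : X t → ∀ A → HProv X (A ⊃ ◇ A)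
  axb  : X b → ∀ A → HProv X (A ⊃ □ (◇ A))
  ax4' : X ax4 → ∀ A → HProv X (□ A ⊃ □ (□ A))
  ax5' : X ax5 → ∀ A → HProv X (◇ A ⊃ □ (◇ A))
  mp   : ∀ {A B} → HProv X A → HProv X (A ⊃ B) → HProv X B
  nec  : ∀ {A} → HProv X A → HProv X (□ A)

-- Each rule becomes a Hilbert-derivable implication from the formulas of its
-- premises to the formula of its conclusion. Propositional steps are
-- tautologies for valuations treating □-formulas as atoms; a rule applied
-- inside a context is lifted by necessitation and K, the hole of a context
-- being a positive position. The axioms d, t, b, 4 justify [d], [t], [b], [4]
-- directly. For [5], with D the formula of Δ: by axiom 5, once □D fails it
-- fails in every box below, where [Δ] can be dropped; and K5 proves
-- ◇□D ⊃ □□D and □(□D ⊃ □□D), so once □D holds inside a box it holds in every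
-- box below, where [Δ] can be added. Splitting on these cases where the paths
-- to the two holes diverge shows that moving [Δ] preserves truth.
module Submission where

open import Defs
open import Data.Bool using (T; true; false; not)
open import Data.Bool.Properties using (T-∧; T-∨; T-≡; not-involutive; ∨-inverseʳ; ∨-∧-booleanAlgebra)
open import Algebra.Lattice.Properties.BooleanAlgebra ∨-∧-booleanAlgebra using (deMorgan₁; deMorgan₂)
open import Data.Fin using (zero; suc)
open import Data.List using (List; []; _∷_; _++_; [_])
open import Data.List.Relation.Unary.All using (All; []; _∷_)
open import Data.List.Relation.Unary.Any using (Any; here; there)
open import Data.List.Relation.Unary.Any.Properties using (++⁺ˡ; ++⁺ʳ; ++⁻)
import Data.List.Relation.Binary.Permutation.Propositional as ↭
open import Data.List.Relation.Binary.Permutation.Propositional.Properties using (Any-resp-↭)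
open import Data.Nat using (ℕ; zero; suc; _<_; s≤s; z≤n)
open import Data.Product using (_,_)
open import Data.Sum using (_⊎_; inj₁; inj₂; [_,_]′; fromInj₁; fromInj₂; reduce; map₁; map₂)
open import Data.Vec.Functional as V using (Vector; head; tail; map)
open import Function using (_∘_; id; flip)
open import Function.Bundles using (module Equivalence)
open import Relation.Binary.PropositionalEquality using (_≡_; refl; sym; cong; cong₂; subst)
open import Relation.Nullary using (¬_; Dec; contradiction)
open import Relation.Nullary.Decidable using (T?; map′; toSum; decidable-stable)

private variable
  X : Ax → Set
  v : Val
  A B D : Fm
  As : List Fm
  Γ Σ Σ′ : Seq
  n : ℕ

neg-involutive : ∀ A → neg (neg A) ≡ A
neg-involutive (p n)   = refl
neg-involutive (np n)  = refl
neg-involutive ⊥̇       = refl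
neg-involutive ⊤̇       = refl
neg-involutive (A ∨̇ B) = cong₂ _∨̇_ (neg-involutive A) (neg-involutive B)
neg-involutive (A ∧̇ B) = cong₂ _∧̇_ (neg-involutive A) (neg-involutive B)
neg-involutive (◇ A)   = cong ◇ (neg-involutive A)
neg-involutive (□ A)   = cong □ (neg-involutive A)

eval-neg : ∀ v A → eval v (neg A) ≡ not (eval v A)
eval-neg v (p n)   = refl
eval-neg v (np n)  = sym (not-involutive _)
eval-neg v ⊥̇       = refl
eval-neg v ⊤̇       = refl
eval-neg v (A ∨̇ B) rewrite eval-neg v A | eval-neg v B = sym (deMorgan₂ (eval v A) (eval v B))
eval-neg v (A ∧̇ B) rewrite eval-neg v A | eval-neg v B = sym (deMorgan₁ (eval v A) (eval v B))
eval-neg v (◇ A)   = sym (not-involutive _)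
eval-neg v (□ A)   = cong (not ∘ Val.boxv v) (neg-involutive A)

-- A record, so that unification can read the formula off the type.
record _⊨_ (v : Val) (A : Fm) : Set where
  constructor holds
  field truth : T (eval v A)
open _⊨_

_⊨?_ : ∀ v A → Dec (v ⊨ A)
v ⊨? A = map′ holds truth (T? (eval v A))

bivalent : ∀ v A → v ⊨ A ⊎ ¬ v ⊨ A
bivalent v A = toSum (v ⊨? A)

T-not⁺ : ∀ {b} → ¬ T b → T (not b)
T-not⁺ {false} _  = _
T-not⁺ {true}  ¬t = ¬t _

T-not⁻ : ∀ {b} → T (not b) → ¬ T b
T-not⁻ {false} _ ()
T-not⁻ {true}  ()

⊨-neg⁺ : ¬ v ⊨ A → v ⊨ neg A
⊨-neg⁺ {v} {A} ¬a = holds (subst T (sym (eval-neg v A)) (T-not⁺ (¬a ∘ holds)))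

⊨-neg⁻ : v ⊨ neg A → ¬ v ⊨ A
⊨-neg⁻ {v} {A} n a = T-not⁻ (subst T (eval-neg v A) (truth n)) (truth a)

⊨-⊃⁺ : (v ⊨ A → v ⊨ B) → v ⊨ (A ⊃ B)
⊨-⊃⁺ {v} {A} f =
  holds (Equivalence.from T-∨ ([ inj₂ ∘ truth ∘ f , inj₁ ∘ truth ∘ ⊨-neg⁺ ]′ (bivalent v A)))

⊨-⊃⁻ : v ⊨ (A ⊃ B) → v ⊨ A → v ⊨ B
⊨-⊃⁻ e a = [ (λ n → contradiction a (⊨-neg⁻ (holds n))) , holds ]′ (Equivalence.to T-∨ (truth e))

⊨-◇⁺ : ¬ v ⊨ □ (neg A) → v ⊨ ◇ A
⊨-◇⁺ ¬□ = holds (T-not⁺ (¬□ ∘ holds))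

⊨-◇⁻ : v ⊨ ◇ A → ¬ v ⊨ □ (neg A)
⊨-◇⁻ ◇A □¬A = T-not⁻ (truth ◇A) (truth □¬A)

⊨-◇neg⁺ : ¬ v ⊨ □ A → v ⊨ ◇ (neg A)
⊨-◇neg⁺ {v} {A} ¬□A = ⊨-◇⁺ (¬□A ∘ subst (λ B → v ⊨ □ B) (neg-involutive A))

⊨-◇neg⁻ : v ⊨ ◇ (neg A) → ¬ v ⊨ □ A
⊨-◇neg⁻ {v} {A} ◇¬A = ⊨-◇⁻ ◇¬A ∘ subst (λ B → v ⊨ □ B) (sym (neg-involutive A))

_⊨ᵢ_ : Val → Item → Set
v ⊨ᵢ fm A = v ⊨ A
v ⊨ᵢ bx Δ = v ⊨ □ (fmla Δ)

_⊨ˢ_ : Val → Seq → Set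
v ⊨ˢ Γ = Any (v ⊨ᵢ_) Γ

disj⁺ : ∀ As → Any (v ⊨_) As → v ⊨ disj As
disj⁺ (A ∷ [])     (here a)  = a
disj⁺ (A ∷ B ∷ As) (here a)  = holds (Equivalence.from T-∨ (inj₁ (truth a)))
disj⁺ (A ∷ B ∷ As) (there s) = holds (Equivalence.from T-∨ (inj₂ (truth (disj⁺ (B ∷ As) s))))

disj⁻ : ∀ As → v ⊨ disj As → Any (v ⊨_) As
disj⁻ (A ∷ [])     a = here a
disj⁻ (A ∷ B ∷ As) e =
  [ here ∘ holds , there ∘ disj⁻ (B ∷ As) ∘ holds ]′ (Equivalence.to T-∨ (truth e))

fmls⁻ : ∀ Γ → Any (v ⊨_) (fmls Γ) → v ⊨ˢ Γ
fmls⁻ (fm A ∷ Γ) (here a)  = here a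
fmls⁻ (fm A ∷ Γ) (there s) = there (fmls⁻ Γ s)
fmls⁻ (bx Δ ∷ Γ) s         = there (fmls⁻ Γ s)

boxFs⁻ : ∀ Γ → Any (v ⊨_) (boxFs Γ) → v ⊨ˢ Γ
boxFs⁻ (fm A ∷ Γ) s         = there (boxFs⁻ Γ s)
boxFs⁻ (bx Δ ∷ Γ) (here □Δ) = here □Δ
boxFs⁻ (bx Δ ∷ Γ) (there s) = there (boxFs⁻ Γ s)

fmls-or-boxFs : ∀ Γ → v ⊨ˢ Γ → Any (v ⊨_) (fmls Γ) ⊎ Any (v ⊨_) (boxFs Γ)
fmls-or-boxFs (fm A ∷ Γ) (here a)  = inj₁ (here a)
fmls-or-boxFs (bx Δ ∷ Γ) (here □Δ) = inj₂ (here □Δ)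
fmls-or-boxFs (fm A ∷ Γ) (there s) = map₁ there (fmls-or-boxFs Γ s)
fmls-or-boxFs (bx Δ ∷ Γ) (there s) = map₂ there (fmls-or-boxFs Γ s)

fmla⁺ : v ⊨ˢ Γ → v ⊨ fmla Γ
fmla⁺ {Γ = Γ} s = disj⁺ (fmls Γ ++ boxFs Γ) ([ ++⁺ˡ , ++⁺ʳ (fmls Γ) ]′ (fmls-or-boxFs Γ s))

fmla⁻ : v ⊨ fmla Γ → v ⊨ˢ Γ
fmla⁻ {Γ = Γ} e = [ fmls⁻ Γ , boxFs⁻ Γ ]′ (++⁻ (fmls Γ) (disj⁻ (fmls Γ ++ boxFs Γ) e))

_⊨ˢ?_ : ∀ v Γ → Dec (v ⊨ˢ Γ)
v ⊨ˢ? Γ = map′ fmla⁻ fmla⁺ (v ⊨? fmla Γ)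

++-monoʳ : ∀ {P : Item → Set} Γ → (Any P Σ → Any P Σ′) → Any P (Γ ++ Σ) → Any P (Γ ++ Σ′)
++-monoʳ Γ f = [ ++⁺ˡ , ++⁺ʳ Γ ∘ f ]′ ∘ ++⁻ Γ

infix 4 _⟹_ _⇛_

_⟹_ : Seq → Seq → Fm
Σ ⟹ Σ′ = fmla Σ ⊃ fmla Σ′

_⇛_ : Vector Seq n → Seq → Fm
_⇛_ {zero}  _  Σ = fmla Σ
_⇛_ {suc n} Ss Σ = fmla (head Ss) ⊃ (tail Ss ⇛ Σ)

⊨-⟹⁺ : ∀ Σ Σ′ → (v ⊨ˢ Σ → v ⊨ˢ Σ′) → v ⊨ (Σ ⟹ Σ′)
⊨-⟹⁺ Σ Σ′ f = ⊨-⊃⁺ (fmla⁺ ∘ f ∘ fmla⁻)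

⊨-⇛⁺ : ∀ (Ss : Vector Seq n) Σ → ((∀ i → v ⊨ˢ Ss i) → v ⊨ˢ Σ) → v ⊨ (Ss ⇛ Σ)
⊨-⇛⁺ {zero}  Ss Σ f = fmla⁺ (f λ ())
⊨-⇛⁺ {suc n} Ss Σ f = ⊨-⊃⁺ λ s → ⊨-⇛⁺ (tail Ss) Σ λ ss → f λ { zero → fmla⁻ s ; (suc i) → ss i }

⊨-⇛⁻ : ∀ (Ss : Vector Seq n) Σ → v ⊨ (Ss ⇛ Σ) → (∀ i → v ⊨ˢ Ss i) → v ⊨ˢ Σ
⊨-⇛⁻ {zero}  Ss Σ e _  = fmla⁻ e
⊨-⇛⁻ {suc n} Ss Σ e ss = ⊨-⇛⁻ (tail Ss) Σ (⊨-⊃⁻ e (fmla⁺ (ss zero))) (ss ∘ suc)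

taut-consequence : All (HProv X) As → (∀ v → All (v ⊨_) As → v ⊨ B) → HProv X B
taut-consequence []       f = taut λ v → Equivalence.to T-≡ (truth (f v []))
taut-consequence (h ∷ hs) f = mp h (taut-consequence hs λ v es → ⊨-⊃⁺ λ e → f v (e ∷ es))

⟹-consequence : ∀ Σ Σ′ → All (HProv X) As →
                (∀ v → All (v ⊨_) As → v ⊨ˢ Σ → v ⊨ˢ Σ′) → HProv X (Σ ⟹ Σ′)
⟹-consequence Σ Σ′ hs f = taut-consequence hs λ v es → ⊨-⟹⁺ Σ Σ′ (f v es)

⊃-refl : HProv X (A ⊃ A)
⊃-refl = taut-consequence [] λ _ _ → ⊨-⊃⁺ id

⊃-trans : HProv X (A ⊃ B) → HProv X (B ⊃ D) → HProv X (A ⊃ D)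
⊃-trans f g = taut-consequence (f ∷ g ∷ []) λ { _ (A⊃B ∷ B⊃D ∷ []) → ⊨-⊃⁺ (⊨-⊃⁻ B⊃D ∘ ⊨-⊃⁻ A⊃B) }

□-mono : HProv X (A ⊃ B) → HProv X (□ A ⊃ □ B)
□-mono {A = A} {B} h = mp (nec h) (axK A B)

□-mono₂ : HProv X (A ⊃ (B ⊃ D)) → HProv X (□ A ⊃ (□ B ⊃ □ D))
□-mono₂ {B = B} {D} h = ⊃-trans (□-mono h) (axK B D)

∧-intro : HProv X (A ⊃ (B ⊃ A ∧̇ B))
∧-intro = taut-consequence [] λ _ _ →
  ⊨-⊃⁺ λ a → ⊨-⊃⁺ λ b → holds (Equivalence.from T-∧ (truth a , truth b))

++-⇛ : ∀ Γ (Ss : Vector Seq n) Σ → HProv X (Ss ⇛ Σ) → HProv X (map (Γ ++_) Ss ⇛ (Γ ++ Σ))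
++-⇛ Γ Ss Σ h = taut-consequence (h ∷ []) λ { v (Ss⇛Σ ∷ []) →
  ⊨-⇛⁺ (map (Γ ++_) Ss) (Γ ++ Σ) λ Γ++Ss →
    [ ++⁺ˡ
    , (λ ¬Γ → ++⁺ʳ Γ (⊨-⇛⁻ Ss Σ Ss⇛Σ λ i → fromInj₂ (flip contradiction ¬Γ) (++⁻ Γ (Γ++Ss i))))
    ]′ (toSum (v ⊨ˢ? Γ)) }

boxed : Seq → Seq
boxed Σ = [ bx Σ ]

K-⇛ : ∀ (Ss : Vector Seq n) Σ → HProv X (□ (Ss ⇛ Σ) ⊃ (map boxed Ss ⇛ boxed Σ))
K-⇛ {zero}  _  _ = ⊃-refl
K-⇛ {suc n} Ss Σ = taut-consequence (axK (fmla (head Ss)) (tail Ss ⇛ Σ) ∷ K-⇛ (tail Ss) Σ ∷ [])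
  λ { _ (K ∷ IH ∷ []) → ⊨-⊃⁺ λ □⇛ → ⊨-⊃⁺ λ □S → ⊨-⊃⁻ IH (⊨-⊃⁻ (⊨-⊃⁻ K □⇛) □S) }

fill-⇛ : ∀ C (Ss : Vector Seq n) Σ → HProv X (Ss ⇛ Σ) → HProv X (map (fill C) Ss ⇛ fill C Σ)
fill-⇛ (here Γ)     Ss Σ h = ++-⇛ Γ Ss Σ h
fill-⇛ (inside Γ C) Ss Σ h =
  ++-⇛ Γ (map (boxed ∘ fill C) Ss) (boxed (fill C Σ))
    (mp (nec (fill-⇛ C Ss Σ h)) (K-⇛ (map (fill C) Ss) (fill C Σ)))

fill-⟹ : ∀ C → HProv X (Σ ⟹ Σ′) → HProv X (fill C Σ ⟹ fill C Σ′)
fill-⟹ {Σ = Σ} {Σ′} C = fill-⇛ C (Σ V.∷ V.[]) Σ′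

weakenʳ : ∀ Σ Γ → HProv X (Σ ⟹ Σ ++ Γ)
weakenʳ Σ Γ = ⟹-consequence Σ (Σ ++ Γ) [] λ _ _ → ++⁺ˡ

weakenˡ : ∀ Γ Σ → HProv X (Σ ⟹ Γ ++ Σ)
weakenˡ Γ Σ = ⟹-consequence Σ (Γ ++ Σ) [] λ _ _ → ++⁺ʳ Γ

add-bx : ∀ C Δ → HProv X (fill C [] ⟹ fill C [ bx Δ ])
add-bx C Δ = fill-⟹ C (⟹-consequence [] [ bx Δ ] [] λ _ _ ())

kR-sound : ∀ A Δ → HProv X ([ bx (fm A ∷ Δ) ] ⟹ fm (◇ A) ∷ bx Δ ∷ [])
kR-sound A Δ = ⟹-consequence [ bx (fm A ∷ Δ) ] (fm (◇ A) ∷ bx Δ ∷ []) (□-mono₂ resolve ∷ [])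
  λ { v (K ∷ []) (here □A∷Δ) →
        [ (λ □¬A → there (here (⊨-⊃⁻ (⊨-⊃⁻ K □¬A) □A∷Δ)))
        , here ∘ ⊨-◇⁺
        ]′ (bivalent v (□ (neg A))) }
  where
  resolve : HProv X (neg A ⊃ (fm A ∷ Δ ⟹ Δ))
  resolve = taut-consequence [] λ _ _ → ⊨-⊃⁺ λ ¬A → ⊨-⟹⁺ (fm A ∷ Δ) Δ
    λ { (here a) → contradiction a (⊨-neg⁻ ¬A) ; (there δ) → δ }

ctr-sound : ∀ Δ → HProv X (Δ ++ Δ ⟹ Δ)
ctr-sound Δ = ⟹-consequence (Δ ++ Δ) Δ [] λ _ _ → reduce ∘ ++⁻ Δ

exch-sound : ∀ i j Δ → HProv X (i ∷ j ∷ Δ ⟹ j ∷ i ∷ Δ)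
exch-sound i j Δ = ⟹-consequence (i ∷ j ∷ Δ) (j ∷ i ∷ Δ) [] λ _ _ → Any-resp-↭ (↭.swap i j ↭.refl)

dR-sound : X d → HProv X ([ bx [] ] ⟹ [])
dR-sound xd = ⟹-consequence [ bx [] ] [] (axd xd ⊥̇ ∷ nec {A = ⊤̇} (taut λ _ → refl) ∷ [])
  λ { _ (axD ∷ □⊤ ∷ []) (here □⊥) → contradiction □⊤ (⊨-◇⁻ (⊨-⊃⁻ axD □⊥)) }

tR-sound : X t → ∀ Δ → HProv X ([ bx Δ ] ⟹ Δ)
tR-sound xt Δ = ⟹-consequence [ bx Δ ] Δ (axt xt (neg (fmla Δ)) ∷ [])
  λ { v (axT ∷ []) (here □Δ) → decidable-stable (v ⊨ˢ? Δ)
        λ ¬Δ → ⊨-◇neg⁻ (⊨-⊃⁻ axT (⊨-neg⁺ (¬Δ ∘ fmla⁻))) □Δ }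

bR-sound : X b → ∀ Δ Σ → HProv X ([ bx (Δ ++ [ bx Σ ]) ] ⟹ bx Δ ∷ Σ)
bR-sound xb Δ Σ = ⟹-consequence [ bx (Δ ++ [ bx Σ ]) ] (bx Δ ∷ Σ)
  (axb xb (neg (fmla Σ)) ∷ □-mono₂ resolve ∷ [])
  λ { v (axB ∷ K ∷ []) (here □Δ,Σ) →
        [ there
        , (λ ¬Σ → here (⊨-⊃⁻ (⊨-⊃⁻ K (⊨-⊃⁻ axB (⊨-neg⁺ (¬Σ ∘ fmla⁻)))) □Δ,Σ))
        ]′ (toSum (v ⊨ˢ? Σ)) }
  where
  resolve : HProv X (◇ (neg (fmla Σ)) ⊃ (Δ ++ [ bx Σ ] ⟹ Δ))
  resolve = taut-consequence [] λ _ _ → ⊨-⊃⁺ λ ◇¬Σ → ⊨-⟹⁺ (Δ ++ [ bx Σ ]) Δ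
    λ Δ,Σ → fromInj₁ (λ { (here □Σ) → contradiction □Σ (⊨-◇neg⁻ ◇¬Σ) }) (++⁻ Δ Δ,Σ)

4R-sound : X ax4 → ∀ Δ Σ → HProv X (bx Δ ∷ bx Σ ∷ [] ⟹ [ bx (bx Δ ∷ Σ) ])
4R-sound x4 Δ Σ = ⟹-consequence (bx Δ ∷ bx Σ ∷ []) [ bx (bx Δ ∷ Σ) ]
  (⊃-trans (ax4' x4 (fmla Δ)) (□-mono (weakenʳ [ bx Δ ] Σ)) ∷ □-mono (weakenˡ [ bx Δ ] Σ) ∷ [])
  λ { _ (fromΔ ∷ _ ∷ []) (here □Δ) → here (⊨-⊃⁻ fromΔ □Δ)
    ; _ (_ ∷ fromΣ ∷ []) (there (here □Σ)) → here (⊨-⊃⁻ fromΣ □Σ) }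

module _ {X : Ax → Set} (x5 : X ax5) where

  ◇□⊃□ : ∀ A → HProv X (◇ (□ A) ⊃ □ A)
  ◇□⊃□ A = taut-consequence (ax5' x5 (neg A) ∷ []) λ { v (five ∷ []) → ⊨-⊃⁺ λ ◇□A →
    decidable-stable (v ⊨? □ A) λ ¬□A → ⊨-◇⁻ ◇□A (⊨-⊃⁻ five (⊨-◇neg⁺ ¬□A)) }

  ◇□⊃□□ : ∀ A → HProv X (◇ (□ A) ⊃ □ (□ A))
  ◇□⊃□□ A = ⊃-trans (ax5' x5 (□ A)) (□-mono (◇□⊃□ A))

  □-shift-T : ∀ A → HProv X (□ (□ A ⊃ A))
  □-shift-T A =
    taut-consequence (□-mono true-case ∷ ⊃-trans (ax5' x5 (neg A)) (□-mono false-case) ∷ [])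
    λ { v (□A⇒ ∷ ◇¬A⇒ ∷ []) → [ ⊨-⊃⁻ □A⇒ , ⊨-⊃⁻ ◇¬A⇒ ∘ ⊨-◇neg⁺ ]′ (bivalent v (□ A)) }
    where
    true-case : HProv X (A ⊃ (□ A ⊃ A))
    true-case = taut-consequence [] λ _ _ → ⊨-⊃⁺ λ a → ⊨-⊃⁺ λ _ → a
    false-case : HProv X (◇ (neg A) ⊃ (□ A ⊃ A))
    false-case = taut-consequence [] λ _ _ → ⊨-⊃⁺ λ ◇¬A → ⊨-⊃⁺ λ □A → contradiction □A (⊨-◇neg⁻ ◇¬A)

  □-shift-4 : ∀ A → HProv X (□ (□ A ⊃ □ (□ A)))
  □-shift-4 A = mp (nec (◇□⊃□□ A)) (mp (□-shift-T (◇ (neg A))) (□-mono₂ (taut-consequence [] λ _ _ →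
    ⊨-⊃⁺ λ T◇¬A → ⊨-⊃⁺ λ ◇□⇒□□ → ⊨-⊃⁺ λ □A →
      ⊨-⊃⁻ ◇□⇒□□ (⊨-◇⁺ λ □◇¬A → ⊨-◇neg⁻ (⊨-⊃⁻ T◇¬A □◇¬A) □A))))

  drop-bx : ∀ C Δ → HProv X (◇ (neg (fmla Δ)) ⊃ (fill C [ bx Δ ] ⟹ fill C []))
  drop-bx (here Γ) Δ = taut-consequence [] λ _ _ → ⊨-⊃⁺ λ ◇¬Δ →
    ⊨-⟹⁺ (Γ ++ [ bx Δ ]) (Γ ++ []) (++-monoʳ Γ λ { (here □Δ) → contradiction □Δ (⊨-◇neg⁻ ◇¬Δ) })
  drop-bx (inside Γ C) Δ = taut-consequence (ax5' x5 (neg (fmla Δ)) ∷ □-mono₂ (drop-bx C Δ) ∷ [])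
    λ { _ (five ∷ drop ∷ []) → ⊨-⊃⁺ λ ◇¬Δ →
      ⊨-⟹⁺ (fill (inside Γ C) [ bx Δ ]) (fill (inside Γ C) [])
        (++-monoʳ Γ λ { (here □C[Δ]) → here (⊨-⊃⁻ (⊨-⊃⁻ drop (⊨-⊃⁻ five ◇¬Δ)) □C[Δ]) }) }

  □□⊃□-fill : ∀ C Δ → HProv X (□ (□ (fmla Δ)) ⊃ □ (fmla (fill C [ bx Δ ])))
  □□⊃□-fill (here Γ)     Δ = □-mono (weakenˡ Γ [ bx Δ ])
  □□⊃□-fill (inside Γ C) Δ = ⊃-trans (mp (□-shift-4 (fmla Δ)) (axK _ _))
    (□-mono (⊃-trans (□□⊃□-fill C Δ) (weakenˡ Γ [ bx (fill C [ bx Δ ]) ])))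

  5R-leftIn : ∀ C Δ → HProv X ([ bx (fill C [ bx Δ ]) ] ⟹ bx (fill C []) ∷ bx Δ ∷ [])
  5R-leftIn C Δ = ⟹-consequence [ bx (fill C [ bx Δ ]) ] (bx (fill C []) ∷ bx Δ ∷ [])
    (ax5' x5 (neg (fmla Δ)) ∷ □-mono₂ (drop-bx C Δ) ∷ [])
    λ { v (five ∷ drop ∷ []) (here □C[Δ]) →
      [ there ∘ here
      , (λ ¬□Δ → here (⊨-⊃⁻ (⊨-⊃⁻ drop (⊨-⊃⁻ five (⊨-◇neg⁺ ¬□Δ))) □C[Δ]))
      ]′ (bivalent v (□ (fmla Δ))) }

  5R-split : ∀ C₁ C₂ Δ →
    HProv X (bx (fill C₁ [ bx Δ ]) ∷ bx (fill C₂ []) ∷ [] ⟹ bx (fill C₁ []) ∷ bx (fill C₂ [ bx Δ ]) ∷ [])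
  5R-split C₁ C₂ Δ =
    ⟹-consequence (bx (fill C₁ [ bx Δ ]) ∷ bx (fill C₂ []) ∷ []) (bx (fill C₁ []) ∷ bx (fill C₂ [ bx Δ ]) ∷ [])
    (□-mono₂ (drop-bx C₁ Δ) ∷ ⊃-trans (◇□⊃□□ (fmla Δ)) (□□⊃□-fill C₂ Δ) ∷ □-mono (add-bx C₂ Δ) ∷ [])
    λ { v (drop ∷ add ∷ _ ∷ []) (here □C₁[Δ]) →
          [ (λ □◇¬Δ → here (⊨-⊃⁻ (⊨-⊃⁻ drop □◇¬Δ) □C₁[Δ]))
          , there ∘ here ∘ ⊨-⊃⁻ add ∘ ⊨-◇⁺
          ]′ (bivalent v (□ (◇ (neg (fmla Δ)))))
      ; _ (_ ∷ _ ∷ weaken ∷ []) (there (here □C₂)) → there (here (⊨-⊃⁻ weaken □C₂)) }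

  5R-sound : ∀ K Δ → 0 < depth2 K → HProv X (fill2 K [ bx Δ ] [] ⟹ fill2 K [] [ bx Δ ])
  -- Under a box the depth condition can be dropped: □D ⊃ □□D holds there, so
  -- [Δ] may also be moved from the top level of the box into a deeper one.
  5R-□ : ∀ K Δ → HProv X (□ (fill2 K [ bx Δ ] [] ⟹ fill2 K [] [ bx Δ ]))

  5R-sound (leftIn Γ C)     Δ _ = fill-⟹ (here Γ) (5R-leftIn C Δ)
  5R-sound (split Γ C₁ C₂)  Δ _ = fill-⟹ (here Γ) (5R-split C₁ C₂ Δ)
  5R-sound (deeper Γ K)     Δ _ = fill-⟹ (here Γ) (mp (5R-□ K Δ) (axK _ _))

  5R-□ K@(leftIn _ _)    Δ = nec (5R-sound K Δ (s≤s z≤n))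
  5R-□ K@(split _ _ _)   Δ = nec (5R-sound K Δ (s≤s z≤n))
  5R-□ K@(deeper _ _)    Δ = nec (5R-sound K Δ (s≤s z≤n))
  5R-□ (both Γ)          Δ = nec ⊃-refl
  5R-□ (rightIn Γ C)     Δ =
    mp (□-shift-4 (fmla Δ)) (□-mono (taut-consequence (□□⊃□-fill C Δ ∷ □-mono (add-bx C Δ) ∷ [])
    λ { _ (add ∷ weaken ∷ []) → ⊨-⊃⁺ λ □⇒□□ →
      ⊨-⟹⁺ (Γ ++ bx Δ ∷ bx (fill C []) ∷ []) (Γ ++ bx (fill C [ bx Δ ]) ∷ [])
        (++-monoʳ Γ λ { (here □Δ) → here (⊨-⊃⁻ add (⊨-⊃⁻ □⇒□□ □Δ))
                      ; (there (here □C)) → here (⊨-⊃⁻ weaken □C) }) }))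

-- The rules ∨ and □ leave the corresponding formula unchanged.
sound : NProv X Γ → HProv X (fmla Γ)
sound (ax C n)           = fill-⇛ C V.[] (fm (p n) ∷ fm (np n) ∷ []) (taut λ v → ∨-inverseʳ (Val.atom v n))
sound (∧R C A B π₁ π₂)   =
  mp (sound π₂) (mp (sound π₁) (fill-⇛ C ([ fm A ] V.∷ [ fm B ] V.∷ V.[]) [ fm (A ∧̇ B) ] ∧-intro))
sound (∨R C A B π)       = mp (sound π) (fill-⟹ C ⊃-refl)
sound (□R C A π)         = mp (sound π) (fill-⟹ C ⊃-refl)
sound (kR C A Δ π)       = mp (sound π) (fill-⟹ C (kR-sound A Δ))
sound (ctr C Δ π)        = mp (sound π) (fill-⟹ C (ctr-sound Δ))
sound (exch C i j Δ π)   = mp (sound π) (fill-⟹ C (exch-sound i j Δ))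
sound (dR xd C π)        = mp (sound π) (fill-⟹ C (dR-sound xd))
sound (tR xt C Δ π)      = mp (sound π) (fill-⟹ C (tR-sound xt Δ))
sound (bR xb C Δ Σ π)    = mp (sound π) (fill-⟹ C (bR-sound xb Δ Σ))
sound (4R x4 C Δ Σ π)    = mp (sound π) (fill-⟹ C (4R-sound x4 Δ Σ))
sound (5R x5 K Δ deep π) = mp (sound π) (5R-sound x5 K Δ deep)

theorem2p36 : (X : Ax → Set) (Γ : Seq) → NProv X Γ → HProv X (fmla Γ)
theorem2p36 _ _ = sound
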